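{- Let $a,b,c>0$ be integers with $\lcm(a,c)=b$. Then $c/\mathrm{alcm}_a b$ is an integer which divides $a$ and is coprime with $\mathrm{alcm}_a b$.
   Context: For integers $a,b>0$ with $a\mid b$, the anti-lcm $\mathrm{alcm}_a b$ of $b$ with respect to $a$ is the smallest positive integer $c$ such that $\lcm(a,c)=b$. -}

module Defs where

open import Data.Nat using (ℕ; _<_; _≤_)
open import Data.Nat.LCM using (lcm)
open import Data.Product using (_×_)
open import Relation.Binary.PropositionalEquality using (_≡_)

IsAlcm : ℕ → ℕ → ℕ → Set
IsAlcm a b d = (0 < d) × (lcm a d ≡ b) × (∀ e → 0 < e → lcm a e ≡ b → d ≤ e)

{-# OPTIONS --safe #-}
-- Write d = alcm_a b. Since lcm distributes over gcd, lcm(a, gcd(d,c)) = gcd(b,b) = b,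
-- so minimality of d forces gcd(d,c) = d, i.e. d ∣ c. Put b = q d, so that
-- a = q gcd(a,d). If h = gcd(q,d) and d = h e, then h ∣ q makes gcd(a,d) = h gcd(a,e),
-- whence lcm(a,e) = b; minimality gives d ≤ e, so h = 1. Finally c = k d with
-- k d ∣ b = q d, so k ∣ q ∣ a, and k is coprime to d because q is.
module Submission where

open import Defs
open import Data.Nat using (ℕ; _<_; _*_)
open import Data.Nat.LCM using (lcm)
open import Data.Nat.Divisibility using (_∣_)
open import Data.Nat.Coprimality using (Coprime)
open import Data.Product using (_×_; ∃-syntax)
open import Relation.Binary.PropositionalEquality using (_≡_)

open import Data.Nat.Base using (_≤_; NonZero; ≢-nonZero; ≢-nonZero⁻¹; >-nonZero; >-nonZero⁻¹)
open import Data.Nat.Properties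
open import Data.Nat.Divisibility
open import Data.Nat.GCD
open import Data.Nat.LCM using (n∣lcm[m,n]; gcd*lcm)
open import Data.Nat.Coprimality using (coprime⇒gcd≡1; gcd≡1⇒coprime)
open import Data.Product using (_,_)
open import Data.Sum using (inj₁; inj₂)
open import Algebra.Properties.CommutativeSemigroup *-commutativeSemigroup using (x∙yz≈y∙xz)
open import Relation.Binary.PropositionalEquality
open ≡-Reasoning

gcd-nonZeroˡ : ∀ m n .{{_ : NonZero m}} → NonZero (gcd m n)
gcd-nonZeroˡ m n = ≢-nonZero (gcd[m,n]≢0 m n (inj₁ (≢-nonZero⁻¹ m)))

gcd-nonZeroʳ : ∀ m n .{{_ : NonZero n}} → NonZero (gcd m n)
gcd-nonZeroʳ m n = ≢-nonZero (gcd[m,n]≢0 m n (inj₂ (≢-nonZero⁻¹ n)))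

lcm≡⇒gcd*≡* : ∀ m n {l} → lcm m n ≡ l → gcd m n * l ≡ m * n
lcm≡⇒gcd*≡* m n refl = gcd*lcm m n

gcd*≡*⇒lcm≡ : ∀ m n {l} .{{_ : NonZero m}} → gcd m n * l ≡ m * n → lcm m n ≡ l
gcd*≡*⇒lcm≡ m n {l} eq = *-cancelˡ-≡ (lcm m n) l (gcd m n) {{gcd-nonZeroˡ m n}}
  (trans (gcd*lcm m n) (sym eq))

gcd-distribˡ-gcd : ∀ m n o → gcd m (gcd n o) ≡ gcd (gcd m n) (gcd m o)
gcd-distribˡ-gcd m n o = ∣-antisym
  (gcd-greatest (gcd-greatest (gcd[m,n]∣m m (gcd n o)) (∣-trans (gcd[m,n]∣n m (gcd n o)) (gcd[m,n]∣m n o)))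
                (gcd-greatest (gcd[m,n]∣m m (gcd n o)) (∣-trans (gcd[m,n]∣n m (gcd n o)) (gcd[m,n]∣n n o))))
  (gcd-greatest (∣-trans (gcd[m,n]∣m (gcd m n) (gcd m o)) (gcd[m,n]∣m m n))
                (gcd-greatest (∣-trans (gcd[m,n]∣m (gcd m n) (gcd m o)) (gcd[m,n]∣n m n))
                              (∣-trans (gcd[m,n]∣n (gcd m n) (gcd m o)) (gcd[m,n]∣n m o))))

gcd[m*o,n*o]≡gcd[m,n]*o : ∀ m n o → gcd (m * o) (n * o) ≡ gcd m n * o
gcd[m*o,n*o]≡gcd[m,n]*o m n o = begin
  gcd (m * o) (n * o) ≡⟨ cong₂ gcd (*-comm m o) (*-comm n o) ⟩
  gcd (o * m) (o * n) ≡⟨ c*gcd[m,n]≡gcd[cm,cn] o m n ⟨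
  o * gcd m n         ≡⟨ *-comm o (gcd m n) ⟩
  gcd m n * o         ∎

lcm-gcd-closed : ∀ {m n o l} .{{_ : NonZero m}} → lcm m n ≡ l → lcm m o ≡ l → lcm m (gcd n o) ≡ l
lcm-gcd-closed {m} {n} {o} {l} lcm[m,n]≡l lcm[m,o]≡l = gcd*≡*⇒lcm≡ m (gcd n o) (begin
  gcd m (gcd n o) * l                 ≡⟨ cong (_* l) (gcd-distribˡ-gcd m n o) ⟩
  gcd (gcd m n) (gcd m o) * l         ≡⟨ gcd[m*o,n*o]≡gcd[m,n]*o (gcd m n) (gcd m o) l ⟨
  gcd (gcd m n * l) (gcd m o * l)     ≡⟨ cong₂ gcd (lcm≡⇒gcd*≡* m n lcm[m,n]≡l) (lcm≡⇒gcd*≡* m o lcm[m,o]≡l) ⟩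
  gcd (m * n) (m * o)                 ≡⟨ c*gcd[m,n]≡gcd[cm,cn] m n o ⟨
  m * gcd n o                         ∎)

lcm≡*⇒≡*gcd : ∀ m n {q} .{{_ : NonZero n}} → lcm m n ≡ q * n → m ≡ q * gcd m n
lcm≡*⇒≡*gcd m n {q} lcm[m,n]≡q*n = *-cancelʳ-≡ m (q * gcd m n) n (begin
  m * n               ≡⟨ lcm≡⇒gcd*≡* m n lcm[m,n]≡q*n ⟨
  gcd m n * (q * n)   ≡⟨ *-assoc (gcd m n) q n ⟨
  gcd m n * q * n     ≡⟨ cong (_* n) (*-comm (gcd m n) q) ⟩
  q * gcd m n * n     ∎)

gcd[m,h*e]≡h*gcd[m,e] : ∀ m h e → h * gcd m (h * e) ∣ m → gcd m (h * e) ≡ h * gcd m e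
gcd[m,h*e]≡h*gcd[m,e] m h e h*g∣m = ∣-antisym
  (subst (gcd m (h * e) ∣_) (sym (c*gcd[m,n]≡gcd[cm,cn] h m e))
    (gcd-greatest (∣-trans (gcd[m,n]∣m m _) (n∣m*n h)) (gcd[m,n]∣n m _)))
  (gcd-greatest (∣-trans (*-monoʳ-∣ h gcd[m,e]∣g) h*g∣m) (*-monoʳ-∣ h (gcd[m,n]∣n m e)))
  where
  gcd[m,e]∣g : gcd m e ∣ gcd m (h * e)
  gcd[m,e]∣g = gcd-greatest (gcd[m,n]∣m m e) (∣-trans (gcd[m,n]∣n m e) (n∣m*n h))

lcm-cancel-∣cofactor : ∀ {m n h e q} .{{_ : NonZero m}} .{{_ : NonZero h}} .{{_ : NonZero e}} →
                       h * e ≡ n → lcm m n ≡ q * n → h ∣ q → lcm m e ≡ lcm m n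
lcm-cancel-∣cofactor {m} {_} {h} {e} {q} refl lcm≡q*n h∣q =
  gcd*≡*⇒lcm≡ m e (*-cancelˡ-≡ (gcd m e * l) (m * e) h (begin
    h * (gcd m e * l)     ≡⟨ *-assoc h (gcd m e) l ⟨
    h * gcd m e * l       ≡⟨ cong (_* l) g≡h*gcd[m,e] ⟨
    g * l                 ≡⟨ gcd*lcm m (h * e) ⟩
    m * (h * e)           ≡⟨ x∙yz≈y∙xz m h e ⟩
    h * (m * e)           ∎))
  where
  instance
    h*e≢0 : NonZero (h * e)
    h*e≢0 = m*n≢0 h e
  l = lcm m (h * e)
  g = gcd m (h * e)
  m≡q*g : m ≡ q * g
  m≡q*g = lcm≡*⇒≡*gcd m (h * e) {q} lcm≡q*n
  g≡h*gcd[m,e] : g ≡ h * gcd m e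
  g≡h*gcd[m,e] = gcd[m,h*e]≡h*gcd[m,e] m h e
    (subst (h * g ∣_) (sym m≡q*g) (*-monoˡ-∣ g h∣q))

∣-coprime : ∀ {k m n} → k ∣ m → Coprime m n → Coprime k n
∣-coprime {k} {n = n} k∣m coprime[m,n] = gcd≡1⇒coprime (∣1⇒≡1
  (subst (gcd k n ∣_) (coprime⇒gcd≡1 coprime[m,n])
    (gcd-greatest (∣-trans (gcd[m,n]∣m k n) k∣m) (gcd[m,n]∣n k n))))

alcm-∣ : ∀ {a b c d} .{{_ : NonZero a}} → IsAlcm a b d → lcm a c ≡ b → d ∣ c
alcm-∣ {c = c} {d} (d>0 , lcm[a,d]≡b , minimal) lcm[a,c]≡b =
  subst (_∣ c) gcd[d,c]≡d (gcd[m,n]∣n d c)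
  where
  instance
    d≢0 : NonZero d
    d≢0 = >-nonZero d>0
  gcd[d,c]≡d : gcd d c ≡ d
  gcd[d,c]≡d = ≤-antisym (∣⇒≤ (gcd[m,n]∣m d c))
    (minimal (gcd d c) (>-nonZero⁻¹ _ {{gcd-nonZeroˡ d c}}) (lcm-gcd-closed lcm[a,d]≡b lcm[a,c]≡b))

alcm-coprime : ∀ {a b d q} .{{_ : NonZero a}} → IsAlcm a b d → b ≡ q * d → Coprime q d
alcm-coprime {a} {b} {d} {q} (d>0 , lcm[a,d]≡b , minimal) b≡q*d =
  gcd≡1⇒coprime (≤-antisym h≤1 (>-nonZero⁻¹ h))
  where
  instance
    d≢0 : NonZero d
    d≢0 = >-nonZero d>0
  h = gcd q d
  open _∣_ (gcd[m,n]∣n q d) renaming (quotient to e; equality to d≡e*h)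
  h*e≡d : h * e ≡ d
  h*e≡d = trans (*-comm h e) (sym d≡e*h)
  instance
    e≢0 : NonZero e
    e≢0 = m*n≢0⇒m≢0 e {{subst NonZero d≡e*h d≢0}}
    h≢0 : NonZero h
    h≢0 = gcd-nonZeroʳ q d
  lcm[a,e]≡b : lcm a e ≡ b
  lcm[a,e]≡b = trans (lcm-cancel-∣cofactor h*e≡d (trans lcm[a,d]≡b b≡q*d) (gcd[m,n]∣m q d))
                     lcm[a,d]≡b
  h≤1 : h ≤ 1
  h≤1 = *-cancelʳ-≤ h 1 e (subst₂ _≤_ (sym h*e≡d) (sym (*-identityˡ e))
          (minimal e (>-nonZero⁻¹ e) lcm[a,e]≡b))

theorem16 : (a b c d : ℕ) → 0 < a → 0 < b → 0 < c → lcm a c ≡ b →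
    IsAlcm a b d →
    ∃[ k ] ((c ≡ k * d) × (k ∣ a) × Coprime k d)
theorem16 a b c d a>0 _ _ lcm[a,c]≡b alcm@(d>0 , lcm[a,d]≡b , _) =
  k , c≡k*d , ∣-trans k∣q q∣a , ∣-coprime k∣q (alcm-coprime {q = q} alcm b≡q*d)
  where
  instance
    a≢0 : NonZero a
    a≢0 = >-nonZero a>0
    d≢0 : NonZero d
    d≢0 = >-nonZero d>0
  open _∣_ (alcm-∣ alcm lcm[a,c]≡b) renaming (quotient to k; equality to c≡k*d)
  open _∣_ (subst (d ∣_) lcm[a,d]≡b (n∣lcm[m,n] a d)) renaming (quotient to q; equality to b≡q*d)
  k∣q : k ∣ q
  k∣q = *-cancelʳ-∣ d (subst₂ _∣_ c≡k*d b≡q*d (subst (c ∣_) lcm[a,c]≡b (n∣lcm[m,n] a c)))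
  q∣a : q ∣ a
  q∣a = subst (q ∣_) (sym (lcm≡*⇒≡*gcd a d {q} (trans lcm[a,d]≡b b≡q*d))) (m∣m*n _)
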